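{- Let $r\ge1$, regard $a_1,\dots,a_r$ as indeterminates, let $f(x)=(x+a_1)\cdots(x+a_r)$ and $\beta_1,\dots,\beta_r\in\mathbb{N}$. Let $\lambda=(\lambda_1,\dots,\lambda_t)$ be an integer partition, $n=|\lambda|$, and $k\ge t$ an integer. Then the coefficient of $a_1^{\beta_1}\cdots a_r^{\beta_r}$ in $m_\lambda(f(1),\dots,f(k))$ equals the number of $(r+1)$-tuples $(s_0,s_1,\dots,s_r)$ of integer sequences of length $n$ such that $s_0\in S_{\lambda,k}$, $s_0\le s_i\le k+1$ for all $i=1,\dots,r$, and $k+1$ appears exactly $\beta_i$ times in $s_i$ for each $i$.
   Context: $m_\lambda(x_1,\dots,x_k)$ is the monomial symmetric polynomial: the sum of all distinct monomials $x_{\sigma(1)}^{\lambda_1}\cdots x_{\sigma(k)}^{\lambda_k}$, $\sigma\in S_k$, with $\lambda_i=0$ for $i>t$. $S_{\lambda,k}$ is the set of weakly increasing $n$-tuples of elements of $\{1,\dots,k\}$ such that the multiset of multiplicities $\{m(1),\dots,m(k)\}$ ($m(i)$ = number of occurrences of $i$) equals $\{\lambda_1,\dots,\lambda_k\}$. For sequences $u,v$ of length $n$ and an integer $M$, $u\le v$ means $u_p\le v_p$ for all $p$, and $u\le M$ means $u_p\le M$ for all $p$. The sequences $s_1,\dots,s_r$ need not be ordered. -}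

module Defs where

open import Data.Bool using (Bool; true; false; _∧_; if_then_else_)
open import Data.Nat using (ℕ; zero; suc; _+_; _*_; _∸_; _≤ᵇ_; _≡ᵇ_)
open import Data.List as L using (List; []; _∷_; _++_; length; filter; upTo; cartesianProduct; replicate)
open import Data.Vec as V using (Vec; []; _∷_; toList; zipWith; tabulate; allFin; lookup)
open import Data.Fin using (Fin; toℕ)
open import Data.Product using (_×_; _,_)
open import Relation.Nullary using (does)
open import Data.Vec.Properties using (≡-dec)
import Data.Nat as N
open import Data.Fin.Properties using () renaming (_≟_ to _≟F_)

and : List Bool → Bool
and = L.foldr _∧_ true

all : {A : Set} → (A → Bool) → List A → Bool
all p xs = and (L.map p xs)

filterB : {A : Set} → (A → Bool) → List A → List A
filterB p []       = []
filterB p (x ∷ xs) = if p x then x ∷ filterB p xs else filterB p xs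

vecsFrom : {A : Set} → List A → (m : ℕ) → List (Vec A m)
vecsFrom xs zero    = [] ∷ []
vecsFrom xs (suc m) = L.cartesianProductWith _∷_ xs (vecsFrom xs m)

countOcc : ℕ → List ℕ → ℕ
countOcc v xs = length (filter (λ x → v N.≟ x) xs)

-- equality of multisets: every value occurring in either list occurs
-- equally often in both (values occurring in neither have count 0 in both)
sameMultiset : List ℕ → List ℕ → Bool
sameMultiset xs ys = all (λ v → countOcc v xs ≡ᵇ countOcc v ys) (xs ++ ys)

vleq : {n : ℕ} → Vec ℕ n → Vec ℕ n → Bool
vleq u v = and (toList (zipWith _≤ᵇ_ u v))

vleqN : {n : ℕ} → Vec ℕ n → ℕ → Bool
vleqN u M = all (λ x → x ≤ᵇ M) (toList u)

weaklyIncreasing : List ℕ → Bool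
weaklyIncreasing []           = true
weaklyIncreasing (x ∷ [])     = true
weaklyIncreasing (x ∷ y ∷ xs) = (x ≤ᵇ y) ∧ weaklyIncreasing (y ∷ xs)

-- Polynomials in r indeterminates a_1..a_r with ℕ coefficients,
-- represented by their coefficient function on exponent vectors.

Poly : ℕ → Set
Poly r = Vec ℕ r → ℕ

below : {r : ℕ} → Vec ℕ r → List (Vec ℕ r)
below []       = [] ∷ []
below (b ∷ β)  = L.cartesianProductWith _∷_ (upTo (suc b)) (below β)

sumL : List ℕ → ℕ
sumL = L.foldr _+_ 0

_⊕_ : {r : ℕ} → Poly r → Poly r → Poly r
(p ⊕ q) β = p β + q β

_⊗_ : {r : ℕ} → Poly r → Poly r → Poly r
(p ⊗ q) β = sumL (L.map (λ γ → p γ * q (zipWith _∸_ β γ)) (below β))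

constP : {r : ℕ} → ℕ → Poly r
constP {r} c β = if does (≡-dec N._≟_ β (V.replicate r 0)) then c else 0

var : {r : ℕ} → Fin r → Poly r
var {r} i β =
  if does (≡-dec N._≟_ β (tabulate (λ j → if does (i ≟F j) then 1 else 0)))
  then 1 else 0

powP : {r : ℕ} → Poly r → ℕ → Poly r
powP p zero    = constP 1
powP p (suc e) = p ⊗ powP p e

prodP : {r : ℕ} → List (Poly r) → Poly r
prodP = L.foldr _⊗_ (constP 1)

sumP : {r : ℕ} → List (Poly r) → Poly r
sumP = L.foldr _⊕_ (constP 0)

coeff : {r : ℕ} → Poly r → Vec ℕ r → ℕ
coeff p β = p β

fpoly : (r : ℕ) → ℕ → Poly r
fpoly r x = prodP (toList (V.map (λ i → constP x ⊕ var i) (allFin r)))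

sumList : List ℕ → ℕ
sumList = sumL

padded : List ℕ → ℕ → List ℕ
padded λs k = λs ++ replicate (k ∸ length λs) 0

-- m_λ(y_1, …, y_k): the sum of all distinct monomials
-- y_1^α_1 ⋯ y_k^α_k where α is a rearrangement of (λ_1,…,λ_k).
-- Every such α has entries ≤ |λ|, so enumerating {0..|λ|}^k is complete.
monomialSym : {r : ℕ} → List ℕ → (k : ℕ) → (Fin k → Poly r) → Poly r
monomialSym λs k y =
  sumP (L.map (λ α → prodP (toList (tabulate (λ j → powP (y j) (lookup α j)))))
              (filterB (λ α → sameMultiset (toList α) (padded λs k))
                      (vecsFrom (upTo (suc (sumList λs))) k)))

inS : {n : ℕ} → List ℕ → ℕ → Vec ℕ n → Bool
inS λs k s =
  weaklyIncreasing (toList s)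
  ∧ all (λ x → (1 ≤ᵇ x) ∧ (x ≤ᵇ k)) (toList s)
  ∧ sameMultiset (L.map (λ i → countOcc (suc i) (toList s)) (upTo k)) (padded λs k)

goodTuple : {n r : ℕ} → List ℕ → ℕ → Vec ℕ r →
            Vec ℕ n × Vec (Vec ℕ n) r → Bool
goodTuple λs k β (s₀ , ss) =
  inS λs k s₀
  ∧ and (toList (zipWith (λ sᵢ βᵢ → vleq s₀ sᵢ ∧ vleqN sᵢ (suc k)
                                     ∧ (countOcc (suc k) (toList sᵢ) ≡ᵇ βᵢ))
                         ss β))

-- All entries of such tuples lie in
-- {1,…,k+1} (as 1 ≤ s_0 ≤ s_i ≤ k+1), so enumerating sequences with
-- entries in {0,…,k+1} is complete.
countTuples : (r : ℕ) → List ℕ → ℕ → Vec ℕ r → ℕ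
countTuples r λs k β =
  length (filterB (goodTuple λs k β)
                 (cartesianProduct (seqs n) (vecsFrom (seqs n) r)))
  where
    n = sumList λs
    seqs : (m : ℕ) → List (Vec ℕ m)
    seqs m = vecsFrom (upTo (suc (suc k))) m

-- Expanding, m_λ(f(1), …, f(k)) is the sum over the rearrangements α of (λ₁, …, λ_k) of
-- f(1)^α₁ ⋯ f(k)^α_k, a product of linear factors c + aᵢ. The coefficient of a^β in such a
-- product factorises over the variables: the i-th factor is the coefficient of aᵢ^βᵢ in
-- ∏_{c ∈ C} (c + aᵢ), where C contains j with multiplicity α_j (the same C for every i).
-- On the other side, once s₀ is fixed the sequences s₁, …, s_r are chosen independently, and
-- position p of sᵢ is either k + 1 or one of the k + 1 - s₀ₚ values in [s₀ₚ, k]; so the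
-- number of choices of sᵢ is the same coefficient with C = {k + 1 - s₀ₚ}. Finally s₀ ↦ its
-- multiplicities of k, k - 1, …, 1 is a bijection from S_{λ,k} onto the rearrangements α,
-- and it matches the two multisets C.

module Submission where

open import Defs
open import Data.Nat using (ℕ; _≤_; _≥_; _<_; zero; suc)
open import Data.List using (List; length)
open import Data.List.Relation.Unary.All using (All)
open import Data.List.Relation.Unary.Linked using (Linked)
open import Data.Vec using (Vec)
open import Data.Fin using (Fin; toℕ)
open import Relation.Binary.PropositionalEquality using (_≡_)

open import Data.Bool using (Bool; true; false; _∧_; if_then_else_; T)
open import Data.Nat using (_+_; _*_; _∸_; _≤ᵇ_; _≡ᵇ_; _<ᵇ_; z≤n; s≤s; _≟_; _≤?_; _<?_)
open import Data.Nat.Properties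
open import Data.Nat.ListAction.Properties using (sum-++; sum-↭)
open import Data.Nat.Solver using (module +-*-Solver)
open +-*-Solver using (solve; _:=_; _:+_; _:*_)
open import Algebra.Properties.CommutativeSemigroup +-commutativeSemigroup using () renaming (interchange to +-interchange)
open import Data.Product using (_×_; _,_; proj₁; proj₂; Σ; map₁; map₂)
open import Data.Empty using (⊥-elim)
open import Function using (_∘_; id)
open import Relation.Nullary using (Dec; yes; no; does; ¬_)
open import Relation.Nullary.Decidable using (dec-true; dec-false)
open import Relation.Binary.PropositionalEquality using (refl; sym; trans; cong; cong₂; subst; _≢_; module ≡-Reasoning)
open import Relation.Binary.Definitions using (DecidableEquality; Tri; tri<; tri≈; tri>)
import Data.Fin as F
import Data.Fin.Properties as FP
import Data.Vec as V
open V using ([]; _∷_; toList; tabulate; lookup; zipWith; allFin)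
import Data.Vec.Properties as VP
import Data.Vec.Relation.Binary.Equality.Cast as VCast
import Data.List as L
open L using ([]; _∷_; _++_; filter; upTo; replicate; cartesianProductWith; applyUpTo)
import Data.List.Properties as LP
open import Data.List.Relation.Unary.All using ([]; _∷_)
import Data.List.Relation.Unary.All as All
import Data.List.Relation.Unary.All.Properties as AllP
open import Data.List.Relation.Unary.Any using (here; there)
open import Data.List.Relation.Unary.AllPairs using ([]; _∷_)
open import Data.List.Relation.Unary.Linked using ([]; [-]; _∷_)
open import Data.List.Relation.Unary.Unique.Propositional using (Unique)
import Data.List.Relation.Unary.Unique.Propositional.Properties as UniqueP
open import Data.List.Membership.Propositional using (_∈_; _∉_)
import Data.List.Membership.Propositional.Properties as MP
import Data.List.Membership.DecPropositional as DecMembership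
open import Data.List.Relation.Binary.Permutation.Propositional using (_↭_; ↭-refl; ↭-sym; ↭-trans; prep; swap; ↭⇒↭ₛ)
import Data.List.Relation.Binary.Permutation.Propositional as Perm
import Data.List.Relation.Binary.Permutation.Propositional.Properties as PP
open import Data.List.Relation.Unary.Sorted.TotalOrder.Properties using (↗↭↗⇒≋)
open import Data.List.Relation.Binary.Pointwise using (Pointwise-≡⇒≡)

module _ {A : Set} where

  sumL-map-cong : ∀ {f g : A → ℕ} → (∀ x → f x ≡ g x) → ∀ xs → sumL (L.map f xs) ≡ sumL (L.map g xs)
  sumL-map-cong f≗g xs = cong sumL (LP.map-cong f≗g xs)

  sumL-map-zero : ∀ (xs : List A) → sumL (L.map (λ _ → 0) xs) ≡ 0
  sumL-map-zero [] = refl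
  sumL-map-zero (x ∷ xs) = sumL-map-zero xs

  sumL-map-+ : ∀ (f g : A → ℕ) xs → sumL (L.map (λ x → f x + g x) xs) ≡ sumL (L.map f xs) + sumL (L.map g xs)
  sumL-map-+ f g [] = refl
  sumL-map-+ f g (x ∷ xs) rewrite sumL-map-+ f g xs = +-interchange (f x) (g x) _ _

  sumL-map-*ˡ : ∀ c (f : A → ℕ) xs → sumL (L.map (λ x → c * f x) xs) ≡ c * sumL (L.map f xs)
  sumL-map-*ˡ c f [] = sym (*-zeroʳ c)
  sumL-map-*ˡ c f (x ∷ xs) rewrite sumL-map-*ˡ c f xs = sym (*-distribˡ-+ c (f x) _)

  sumL-map-if : ∀ b (g : A → ℕ) xs → sumL (L.map (λ x → if b then g x else 0) xs) ≡ (if b then sumL (L.map g xs) else 0)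
  sumL-map-if true g xs = refl
  sumL-map-if false g xs = sumL-map-zero xs

  sumL-map-++ : ∀ (f : A → ℕ) xs ys → sumL (L.map f (xs ++ ys)) ≡ sumL (L.map f xs) + sumL (L.map f ys)
  sumL-map-++ f xs ys = trans (cong sumL (LP.map-++ f xs ys)) (sum-++ (L.map f xs) _)

sumL-map-cartesianProductWith : ∀ {A B C : Set} (F : C → ℕ) (f : A → B → C) xs ys →
  sumL (L.map F (cartesianProductWith f xs ys)) ≡ sumL (L.map (λ x → sumL (L.map (λ y → F (f x y)) ys)) xs)
sumL-map-cartesianProductWith F f [] ys = refl
sumL-map-cartesianProductWith F f (x ∷ xs) ys = begin
    sumL (L.map F (L.map (f x) ys ++ cartesianProductWith f xs ys))
  ≡⟨ sumL-map-++ F (L.map (f x) ys) _ ⟩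
    sumL (L.map F (L.map (f x) ys)) + sumL (L.map F (cartesianProductWith f xs ys))
  ≡⟨ cong₂ _+_ (cong sumL (sym (LP.map-∘ ys))) (sumL-map-cartesianProductWith F f xs ys) ⟩
    _ ∎
  where open ≡-Reasoning

sumL-map-upTo-suc : ∀ (F : ℕ → ℕ) m → sumL (L.map F (upTo (suc m))) ≡ sumL (L.map F (upTo m)) + F m
sumL-map-upTo-suc F m = begin
    sumL (L.map F (upTo (suc m)))
  ≡⟨ cong (λ l → sumL (L.map F l)) (LP.upTo-∷ʳ m) ⟨
    sumL (L.map F (upTo m L.∷ʳ m))
  ≡⟨ sumL-map-++ F (upTo m) (m ∷ []) ⟩
    sumL (L.map F (upTo m)) + (F m + 0)
  ≡⟨ cong (sumL (L.map F (upTo m)) +_) (+-identityʳ (F m)) ⟩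
    sumL (L.map F (upTo m)) + F m ∎
  where open ≡-Reasoning

sumL-upTo-δ : ∀ (F : ℕ → ℕ) d m → sumL (L.map (λ x → if does (x ≟ d) then F x else 0) (upTo m)) ≡ (if d <ᵇ m then F d else 0)
sumL-upTo-δ F d zero = refl
sumL-upTo-δ F d (suc m) = begin
    sumL (L.map G (upTo (suc m)))
  ≡⟨ sumL-map-upTo-suc G m ⟩
    sumL (L.map G (upTo m)) + G m
  ≡⟨ cong (_+ G m) (sumL-upTo-δ F d m) ⟩
    (if d <ᵇ m then F d else 0) + G m
  ≡⟨ last-term (<-cmp d m) ⟩
    (if d <ᵇ suc m then F d else 0) ∎
  where
  open ≡-Reasoning
  G = λ x → if does (x ≟ d) then F x else 0
  last-term : Tri (d < m) (d ≡ m) (m < d) → (if d <ᵇ m then F d else 0) + G m ≡ (if d <ᵇ suc m then F d else 0)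
  last-term (tri< d<m d≢m _)
    rewrite dec-true (d <? m) d<m | dec-true (d <? suc m) (m<n⇒m<1+n d<m) | dec-false (m ≟ d) (d≢m ∘ sym) = +-identityʳ _
  last-term (tri≈ d≮m refl _)
    rewrite dec-false (d <? d) d≮m | dec-true (d <? suc d) (n<1+n d) | dec-true (d ≟ d) refl = refl
  last-term (tri> d≮m d≢m m<d)
    rewrite dec-false (d <? m) d≮m | dec-false (d <? suc m) (<⇒≱ m<d ∘ ≤-pred) | dec-false (m ≟ d) (d≢m ∘ sym) = refl

module _ {A : Set} where

  length-filterB : ∀ (p : A → Bool) xs → length (filterB p xs) ≡ sumL (L.map (λ x → if p x then 1 else 0) xs)
  length-filterB p [] = refl
  length-filterB p (x ∷ xs) with p x
  ... | true = cong suc (length-filterB p xs)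
  ... | false = length-filterB p xs

  sumL-map-filterB : ∀ (p : A → Bool) (g : A → ℕ) xs → sumL (L.map g (filterB p xs)) ≡ sumL (L.map (λ x → if p x then g x else 0) xs)
  sumL-map-filterB p g [] = refl
  sumL-map-filterB p g (x ∷ xs) with p x
  ... | true = cong (g x +_) (sumL-map-filterB p g xs)
  ... | false = sumL-map-filterB p g xs

  sumL-map-if-const : ∀ (p : A → Bool) m xs → sumL (L.map (λ x → if p x then m else 0) xs) ≡ length (filterB p xs) * m
  sumL-map-if-const p m [] = refl
  sumL-map-if-const p m (x ∷ xs) with p x
  ... | true = cong (m +_) (sumL-map-if-const p m xs)
  ... | false = sumL-map-if-const p m xs

  filterB-cong : ∀ {p q : A → Bool} → (∀ x → p x ≡ q x) → ∀ xs → filterB p xs ≡ filterB q xs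
  filterB-cong p≗q [] = refl
  filterB-cong {p} {q} p≗q (x ∷ xs) rewrite p≗q x with q x
  ... | true = cong (x ∷_) (filterB-cong p≗q xs)
  ... | false = filterB-cong p≗q xs

  length-filterB-∧ : ∀ b (q : A → Bool) xs → length (filterB (λ y → b ∧ q y) xs) ≡ (if b then length (filterB q xs) else 0)
  length-filterB-∧ true q xs = refl
  length-filterB-∧ false q [] = refl
  length-filterB-∧ false q (y ∷ xs) = length-filterB-∧ false q xs

  ∈-filterB⁺ : ∀ (p : A → Bool) {x xs} → x ∈ xs → p x ≡ true → x ∈ filterB p xs
  ∈-filterB⁺ p {x} {y ∷ xs} (here refl) px rewrite px = here refl
  ∈-filterB⁺ p {x} {y ∷ xs} (there x∈xs) px with p y
  ... | true = there (∈-filterB⁺ p x∈xs px)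
  ... | false = ∈-filterB⁺ p x∈xs px

  ∈-filterB⁻ : ∀ (p : A → Bool) {x} xs → x ∈ filterB p xs → x ∈ xs × p x ≡ true
  ∈-filterB⁻ p (y ∷ xs) x∈ with p y in py
  ∈-filterB⁻ p (y ∷ xs) (here refl) | true = here refl , py
  ∈-filterB⁻ p (y ∷ xs) (there x∈) | true = map₁ there (∈-filterB⁻ p xs x∈)
  ... | false = map₁ there (∈-filterB⁻ p xs x∈)

  All-filterB : ∀ (p : A → Bool) {P : A → Set} {xs} → All P xs → All P (filterB p xs)
  All-filterB p {xs = []} [] = []
  All-filterB p {xs = x ∷ xs} (px ∷ pxs) with p x
  ... | true = px ∷ All-filterB p pxs
  ... | false = All-filterB p pxs

  All-filterB-true : ∀ (p : A → Bool) xs → All (λ x → p x ≡ true) (filterB p xs)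
  All-filterB-true p [] = []
  All-filterB-true p (x ∷ xs) with p x in px
  ... | true = px ∷ All-filterB-true p xs
  ... | false = All-filterB-true p xs

  Unique-filterB : ∀ (p : A → Bool) {xs} → Unique xs → Unique (filterB p xs)
  Unique-filterB p {[]} [] = []
  Unique-filterB p {x ∷ xs} (x∉xs ∷ u) with p x
  ... | true = All-filterB p x∉xs ∷ Unique-filterB p u
  ... | false = Unique-filterB p u

length-filterB-cartesianProductWith : ∀ {A B C : Set} (p : C → Bool) (f : A → B → C) xs ys →
  length (filterB p (cartesianProductWith f xs ys)) ≡ sumL (L.map (λ x → length (filterB (λ y → p (f x y)) ys)) xs)
length-filterB-cartesianProductWith p f xs ys = begin
    length (filterB p (cartesianProductWith f xs ys))
  ≡⟨ length-filterB p (cartesianProductWith f xs ys) ⟩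
    sumL (L.map (λ z → if p z then 1 else 0) (cartesianProductWith f xs ys))
  ≡⟨ sumL-map-cartesianProductWith _ f xs ys ⟩
    sumL (L.map (λ x → sumL (L.map (λ y → if p (f x y) then 1 else 0) ys)) xs)
  ≡⟨ sumL-map-cong (λ x → length-filterB (λ y → p (f x y)) ys) xs ⟨
    sumL (L.map (λ x → length (filterB (λ y → p (f x y)) ys)) xs) ∎
  where open ≡-Reasoning

∧-true⁻ : ∀ {a b} → a ∧ b ≡ true → a ≡ true × b ≡ true
∧-true⁻ {true} {true} _ = refl , refl

∧-true⁺ : ∀ {a b} → a ≡ true → b ≡ true → a ∧ b ≡ true
∧-true⁺ refl refl = refl

all-true⁻ : ∀ {A : Set} (p : A → Bool) xs → all p xs ≡ true → All (λ x → p x ≡ true) xs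
all-true⁻ p [] _ = []
all-true⁻ p (x ∷ xs) h = proj₁ (∧-true⁻ h) ∷ all-true⁻ p xs (proj₂ (∧-true⁻ {p x} h))

all-true⁺ : ∀ {A : Set} (p : A → Bool) xs → All (λ x → p x ≡ true) xs → all p xs ≡ true
all-true⁺ p [] _ = refl
all-true⁺ p (x ∷ xs) (px ∷ pxs) = ∧-true⁺ px (all-true⁺ p xs pxs)

-- Multiplying by a linear factor c + aᵢ

_≟ᵥ_ : ∀ {r} → DecidableEquality (Vec ℕ r)
_≟ᵥ_ = VP.≡-dec _≟_

sumL-below-δ : ∀ {r} (β δ : Vec ℕ r) (a : ℕ) (g : Vec ℕ r → ℕ) →
  sumL (L.map (λ γ → (if does (γ ≟ᵥ δ) then a else 0) * g γ) (below β)) ≡ (if vleq δ β then a * g δ else 0)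
sumL-below-δ [] [] a g = +-identityʳ _
sumL-below-δ (b ∷ β) (d ∷ δ) a g = begin
    sumL (L.map (λ γ → (if does (γ ≟ᵥ (d ∷ δ)) then a else 0) * g γ) (below (b ∷ β)))
  ≡⟨ sumL-map-cartesianProductWith _ _∷_ (upTo (suc b)) (below β) ⟩
    sumL (L.map (λ x → sumL (L.map (λ γ → (if does (x ≟ d) ∧ does (γ ≟ᵥ δ) then a else 0) * g (x ∷ γ)) (below β))) (upTo (suc b)))
  ≡⟨ sumL-map-cong inner (upTo (suc b)) ⟩
    sumL (L.map (λ x → if does (x ≟ d) then (if vleq δ β then a * g (x ∷ δ) else 0) else 0) (upTo (suc b)))
  ≡⟨ sumL-upTo-δ (λ x → if vleq δ β then a * g (x ∷ δ) else 0) d (suc b) ⟩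
    (if d <ᵇ suc b then (if vleq δ β then a * g (d ∷ δ) else 0) else 0)
  ≡⟨ cong (λ z → if z then (if vleq δ β then a * g (d ∷ δ) else 0) else 0) (<ᵇ-suc d) ⟩
    (if d ≤ᵇ b then (if vleq δ β then a * g (d ∷ δ) else 0) else 0)
  ≡⟨ if-∧ (d ≤ᵇ b) (vleq δ β) ⟩
    (if vleq (d ∷ δ) (b ∷ β) then a * g (d ∷ δ) else 0) ∎
  where
  open ≡-Reasoning
  inner : ∀ x → sumL (L.map (λ γ → (if does (x ≟ d) ∧ does (γ ≟ᵥ δ) then a else 0) * g (x ∷ γ)) (below β))
             ≡ (if does (x ≟ d) then (if vleq δ β then a * g (x ∷ δ) else 0) else 0)
  inner x with does (x ≟ d)
  ... | true = sumL-below-δ β δ a (λ γ → g (x ∷ γ))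
  ... | false = sumL-map-zero (below β)
  <ᵇ-suc : ∀ d → (d <ᵇ suc b) ≡ (d ≤ᵇ b)
  <ᵇ-suc zero = refl
  <ᵇ-suc (suc d) = refl
  if-∧ : ∀ u v {z : ℕ} → (if u then (if v then z else 0) else 0) ≡ (if u ∧ v then z else 0)
  if-∧ true v = refl
  if-∧ false v = refl

∸-replicate0 : ∀ {r} (β : Vec ℕ r) → zipWith _∸_ β (V.replicate r 0) ≡ β
∸-replicate0 [] = refl
∸-replicate0 (b ∷ β) = cong (b ∷_) (∸-replicate0 β)

vleq-replicate0 : ∀ {r} (β : Vec ℕ r) → vleq (V.replicate r 0) β ≡ true
vleq-replicate0 [] = refl
vleq-replicate0 (b ∷ β) = vleq-replicate0 β

replicate0-tabulate : ∀ r → tabulate {n = r} (λ _ → 0) ≡ V.replicate r 0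
replicate0-tabulate zero = refl
replicate0-tabulate (suc r) = cong (0 ∷_) (replicate0-tabulate r)

unitExp : ∀ {r} → Fin r → Vec ℕ r
unitExp i = tabulate (λ j → if does (i FP.≟ j) then 1 else 0)

-- the coefficient of a^β in aᵢ Q
lowered : ∀ {r} → Fin r → Vec ℕ r → Poly r → ℕ
lowered i β Q = if vleq (unitExp i) β then Q (zipWith _∸_ β (unitExp i)) else 0

lowered-zero : ∀ {r} x (γ : Vec ℕ r) (R : Poly (suc r)) → lowered F.zero (x ∷ γ) R ≡ (if 1 ≤ᵇ x then R ((x ∸ 1) ∷ γ) else 0)
lowered-zero {r} x γ R
  rewrite replicate0-tabulate r | vleq-replicate0 γ | ∸-replicate0 γ with 1 ≤ᵇ x
... | true = refl
... | false = refl

lowered-cong : ∀ {r} (i : Fin r) β {Q Q' : Poly r} → (∀ γ → Q γ ≡ Q' γ) → lowered i β Q ≡ lowered i β Q'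
lowered-cong i β Q≗Q' with vleq (unitExp i) β
... | true = Q≗Q' _
... | false = refl

lowered-*ˡ : ∀ {r} (i : Fin r) β x (Q : Poly r) → lowered i β (λ δ → x * Q δ) ≡ x * lowered i β Q
lowered-*ˡ i β x Q with vleq (unitExp i) β
... | true = refl
... | false = sym (*-zeroʳ x)

linear : ∀ {r} → ℕ → Fin r → Poly r
linear c i = constP c ⊕ var i

⊗-congʳ : ∀ {r} (P : Poly r) {Q Q' : Poly r} → (∀ γ → Q γ ≡ Q' γ) → ∀ β → (P ⊗ Q) β ≡ (P ⊗ Q') β
⊗-congʳ P Q≗Q' β = sumL-map-cong (λ γ → cong (P γ *_) (Q≗Q' _)) (below β)

⊗-congˡ : ∀ {r} {P P' : Poly r} (Q : Poly r) → (∀ γ → P γ ≡ P' γ) → ∀ β → (P ⊗ Q) β ≡ (P' ⊗ Q) β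
⊗-congˡ Q P≗P' β = sumL-map-cong (λ γ → cong (_* Q _) (P≗P' γ)) (below β)

constP-⊗ : ∀ {r} c (Q : Poly r) β → (constP c ⊗ Q) β ≡ c * Q β
constP-⊗ {r} c Q β = begin
    sumL (L.map (λ γ → constP c γ * Q (zipWith _∸_ β γ)) (below β))
  ≡⟨ sumL-below-δ β (V.replicate r 0) c (λ γ → Q (zipWith _∸_ β γ)) ⟩
    (if vleq (V.replicate r 0) β then c * Q (zipWith _∸_ β (V.replicate r 0)) else 0)
  ≡⟨ cong (λ z → if z then c * Q (zipWith _∸_ β (V.replicate r 0)) else 0) (vleq-replicate0 β) ⟩
    c * Q (zipWith _∸_ β (V.replicate r 0))
  ≡⟨ cong (λ γ → c * Q γ) (∸-replicate0 β) ⟩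
    c * Q β ∎
  where open ≡-Reasoning

var-⊗ : ∀ {r} (i : Fin r) (Q : Poly r) β → (var i ⊗ Q) β ≡ lowered i β Q
var-⊗ i Q β with sumL-below-δ β (unitExp i) 1 (λ γ → Q (zipWith _∸_ β γ))
... | eq with vleq (unitExp i) β
...   | true = trans eq (*-identityˡ _)
...   | false = eq

linear-⊗ : ∀ {r} c (i : Fin r) (Q : Poly r) β → (linear c i ⊗ Q) β ≡ c * Q β + lowered i β Q
linear-⊗ c i Q β = begin
    sumL (L.map (λ γ → (constP c γ + var i γ) * Q (zipWith _∸_ β γ)) (below β))
  ≡⟨ sumL-map-cong (λ γ → *-distribʳ-+ (Q (zipWith _∸_ β γ)) (constP c γ) (var i γ)) (below β) ⟩
    sumL (L.map (λ γ → constP c γ * Q (zipWith _∸_ β γ) + var i γ * Q (zipWith _∸_ β γ)) (below β))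
  ≡⟨ sumL-map-+ _ _ (below β) ⟩
    (constP c ⊗ Q) β + (var i ⊗ Q) β
  ≡⟨ cong₂ _+_ (constP-⊗ c Q β) (var-⊗ i Q β) ⟩
    c * Q β + lowered i β Q ∎
  where open ≡-Reasoning

lowered-zero-⊗ : ∀ {r} (R Q : Poly (suc r)) b β →
  sumL (L.map (λ γ → lowered F.zero γ R * Q (zipWith _∸_ (b ∷ β) γ)) (below (b ∷ β))) ≡ lowered F.zero (b ∷ β) (R ⊗ Q)
lowered-zero-⊗ R Q b β = begin
    sumL (L.map (λ γ → lowered F.zero γ R * Q (zipWith _∸_ (b ∷ β) γ)) (below (b ∷ β)))
  ≡⟨ sumL-map-cartesianProductWith _ _∷_ (upTo (suc b)) (below β) ⟩
    sumL (L.map (λ x → sumL (L.map (λ γ → lowered F.zero (x ∷ γ) R * Q ((b ∸ x) ∷ zipWith _∸_ β γ)) (below β))) (upTo (suc b)))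
  ≡⟨ sumL-map-cong (λ x → sumL-map-cong (λ γ → cong (_* Q ((b ∸ x) ∷ zipWith _∸_ β γ)) (lowered-zero x γ R)) (below β)) (upTo (suc b)) ⟩
    slice 0 + sumL (L.map slice (applyUpTo suc b))
  ≡⟨ cong (_+ sumL (L.map slice (applyUpTo suc b))) (sumL-map-zero (below β)) ⟩
    sumL (L.map slice (applyUpTo suc b))
  ≡⟨ cong sumL (LP.map-applyUpTo suc slice b) ⟩
    sumL (applyUpTo (λ y → slice (suc y)) b)
  ≡⟨ shifted b refl ⟩
    lowered F.zero (b ∷ β) (R ⊗ Q) ∎
  where
  open ≡-Reasoning
  slice : ℕ → ℕ
  slice x = sumL (L.map (λ γ → (if 1 ≤ᵇ x then R ((x ∸ 1) ∷ γ) else 0) * Q ((b ∸ x) ∷ zipWith _∸_ β γ)) (below β))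
  shifted : ∀ b' → b' ≡ b → sumL (applyUpTo (λ y → slice (suc y)) b') ≡ lowered F.zero (b' ∷ β) (R ⊗ Q)
  shifted zero _ = sym (lowered-zero zero β (R ⊗ Q))
  shifted (suc b') refl = begin
      sumL (applyUpTo (λ y → slice (suc y)) (suc b'))
    ≡⟨ cong sumL (LP.map-applyUpTo (λ y → y) (λ y → slice (suc y)) (suc b')) ⟨
      sumL (L.map (λ y → slice (suc y)) (upTo (suc b')))
    ≡⟨ sumL-map-cartesianProductWith (λ γ → R γ * Q (zipWith _∸_ (b' ∷ β) γ)) _∷_ (upTo (suc b')) (below β) ⟨
      (R ⊗ Q) (b' ∷ β)
    ≡⟨ lowered-zero (suc b') β (R ⊗ Q) ⟨
      lowered F.zero (suc b' ∷ β) (R ⊗ Q) ∎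

lowered-⊗ : ∀ {r} (i : Fin r) (R Q : Poly r) β →
  sumL (L.map (λ γ → lowered i γ R * Q (zipWith _∸_ β γ)) (below β)) ≡ lowered i β (R ⊗ Q)
lowered-⊗ F.zero R Q (b ∷ β) = lowered-zero-⊗ R Q b β
lowered-⊗ (F.suc i) R Q (b ∷ β) = begin
    sumL (L.map (λ γ → lowered (F.suc i) γ R * Q (zipWith _∸_ (b ∷ β) γ)) (below (b ∷ β)))
  ≡⟨ sumL-map-cartesianProductWith _ _∷_ (upTo (suc b)) (below β) ⟩
    sumL (L.map (λ x → sumL (L.map (λ γ → lowered i γ (R↾ x) * Q↾ x (zipWith _∸_ β γ)) (below β))) (upTo (suc b)))
  ≡⟨ sumL-map-cong (λ x → lowered-⊗ i (R↾ x) (Q↾ x) β) (upTo (suc b)) ⟩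
    sumL (L.map (λ x → lowered i β (R↾ x ⊗ Q↾ x)) (upTo (suc b)))
  ≡⟨ sumL-map-if (vleq (unitExp i) β) (λ x → (R↾ x ⊗ Q↾ x) (zipWith _∸_ β (unitExp i))) (upTo (suc b)) ⟩
    (if vleq (unitExp i) β then sumL (L.map (λ x → (R↾ x ⊗ Q↾ x) (zipWith _∸_ β (unitExp i))) (upTo (suc b))) else 0)
  ≡⟨ cong (λ z → if vleq (unitExp i) β then z else 0)
       (sumL-map-cartesianProductWith (λ γ → R γ * Q (zipWith _∸_ (b ∷ β′) γ)) _∷_ (upTo (suc b)) (below β′)) ⟨
    lowered (F.suc i) (b ∷ β) (R ⊗ Q) ∎
  where
  open ≡-Reasoning
  R↾ Q↾ : ℕ → Poly _
  R↾ x δ = R (x ∷ δ)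
  Q↾ x δ = Q ((b ∸ x) ∷ δ)
  β′ = zipWith _∸_ β (unitExp i)

linear-⊗-assoc : ∀ {r} c (i : Fin r) (R Q : Poly r) β → ((linear c i ⊗ R) ⊗ Q) β ≡ (linear c i ⊗ (R ⊗ Q)) β
linear-⊗-assoc c i R Q β = begin
    sumL (L.map (λ γ → (linear c i ⊗ R) γ * Q (zipWith _∸_ β γ)) (below β))
  ≡⟨ sumL-map-cong expand (below β) ⟩
    sumL (L.map (λ γ → c * (R γ * Q (zipWith _∸_ β γ)) + lowered i γ R * Q (zipWith _∸_ β γ)) (below β))
  ≡⟨ sumL-map-+ _ _ (below β) ⟩
    sumL (L.map (λ γ → c * (R γ * Q (zipWith _∸_ β γ))) (below β)) + sumL (L.map (λ γ → lowered i γ R * Q (zipWith _∸_ β γ)) (below β))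
  ≡⟨ cong₂ _+_ (sumL-map-*ˡ c (λ γ → R γ * Q (zipWith _∸_ β γ)) (below β)) (lowered-⊗ i R Q β) ⟩
    c * (R ⊗ Q) β + lowered i β (R ⊗ Q)
  ≡⟨ linear-⊗ c i (R ⊗ Q) β ⟨
    (linear c i ⊗ (R ⊗ Q)) β ∎
  where
  open ≡-Reasoning
  expand : ∀ γ → (linear c i ⊗ R) γ * Q (zipWith _∸_ β γ) ≡ c * (R γ * Q (zipWith _∸_ β γ)) + lowered i γ R * Q (zipWith _∸_ β γ)
  expand γ = begin
      (linear c i ⊗ R) γ * Q (zipWith _∸_ β γ)
    ≡⟨ cong (_* Q (zipWith _∸_ β γ)) (linear-⊗ c i R γ) ⟩
      (c * R γ + lowered i γ R) * Q (zipWith _∸_ β γ)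
    ≡⟨ *-distribʳ-+ (Q (zipWith _∸_ β γ)) (c * R γ) _ ⟩
      c * R γ * Q (zipWith _∸_ β γ) + lowered i γ R * Q (zipWith _∸_ β γ)
    ≡⟨ cong (_+ lowered i γ R * Q (zipWith _∸_ β γ)) (*-assoc c (R γ) _) ⟩
      c * (R γ * Q (zipWith _∸_ β γ)) + lowered i γ R * Q (zipWith _∸_ β γ) ∎

mulLinear : ∀ {r} → List (ℕ × Fin r) → Poly r → Poly r
mulLinear [] Q = Q
mulLinear ((c , i) ∷ L) Q = linear c i ⊗ mulLinear L Q

mulLinear-cong : ∀ {r} (L : List (ℕ × Fin r)) {Q Q' : Poly r} → (∀ γ → Q γ ≡ Q' γ) → ∀ β → mulLinear L Q β ≡ mulLinear L Q' β
mulLinear-cong [] Q≗Q' β = Q≗Q' β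
mulLinear-cong ((c , i) ∷ L) Q≗Q' β = ⊗-congʳ (linear c i) (mulLinear-cong L Q≗Q') β

mulLinear-++ : ∀ {r} (L M : List (ℕ × Fin r)) Q → mulLinear (L ++ M) Q ≡ mulLinear L (mulLinear M Q)
mulLinear-++ [] M Q = refl
mulLinear-++ ((c , i) ∷ L) M Q = cong (linear c i ⊗_) (mulLinear-++ L M Q)

mulLinear-⊗ : ∀ {r} (L : List (ℕ × Fin r)) (R Q : Poly r) β → (mulLinear L R ⊗ Q) β ≡ mulLinear L (R ⊗ Q) β
mulLinear-⊗ [] R Q β = refl
mulLinear-⊗ ((c , i) ∷ L) R Q β = trans (linear-⊗-assoc c i (mulLinear L R) Q β) (⊗-congʳ (linear c i) (mulLinear-⊗ L R Q) β)

IsLinearProduct : ∀ {r} → Poly r → List (ℕ × Fin r) → Set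
IsLinearProduct P L = ∀ β → P β ≡ mulLinear L (constP 1) β

⊗-IsLinearProduct : ∀ {r} {P Q : Poly r} L M → IsLinearProduct P L → IsLinearProduct Q M → IsLinearProduct (P ⊗ Q) (L ++ M)
⊗-IsLinearProduct {P = P} {Q} L M P≗L Q≗M β = begin
    (P ⊗ Q) β                                      ≡⟨ ⊗-congˡ Q P≗L β ⟩
    (mulLinear L (constP 1) ⊗ Q) β                  ≡⟨ mulLinear-⊗ L (constP 1) Q β ⟩
    mulLinear L (constP 1 ⊗ Q) β                    ≡⟨ mulLinear-cong L (λ γ → trans (constP-⊗ 1 Q γ) (*-identityˡ (Q γ))) β ⟩
    mulLinear L Q β                                 ≡⟨ mulLinear-cong L Q≗M β ⟩
    mulLinear L (mulLinear M (constP 1)) β          ≡⟨ cong (λ P → P β) (mulLinear-++ L M (constP 1)) ⟨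
    mulLinear (L ++ M) (constP 1) β ∎
  where open ≡-Reasoning

powP-IsLinearProduct : ∀ {r} {P : Poly r} L → IsLinearProduct P L → ∀ e → IsLinearProduct (powP P e) (L.concat (replicate e L))
powP-IsLinearProduct L P≗L zero β = refl
powP-IsLinearProduct L P≗L (suc e) = ⊗-IsLinearProduct L _ P≗L (powP-IsLinearProduct L P≗L e)

fFactors : ∀ r → ℕ → List (ℕ × Fin r)
fFactors r x = toList (V.map (x ,_) (allFin r))

fpoly-IsLinearProduct : ∀ r x → IsLinearProduct (fpoly r x) (fFactors r x)
fpoly-IsLinearProduct r x β = cong (λ P → P β) (factors (allFin r))
  where
  factors : ∀ {m} (v : Vec (Fin r) m) → prodP (toList (V.map (λ i → constP x ⊕ var i) v)) ≡ mulLinear (toList (V.map (x ,_) v)) (constP 1)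
  factors [] = refl
  factors (i ∷ v) = cong (linear x i ⊗_) (factors v)

monomialTerm : ∀ {k} r → (Fin k → ℕ) → Vec ℕ k → Poly r
monomialTerm r c α = prodP (toList (tabulate (λ j → powP (fpoly r (c j)) (lookup α j))))

monomialFactors : ∀ {k} r → (Fin k → ℕ) → Vec ℕ k → List (ℕ × Fin r)
monomialFactors r c [] = []
monomialFactors r c (a ∷ α) = L.concat (replicate a (fFactors r (c F.zero))) ++ monomialFactors r (c ∘ F.suc) α

monomialTerm-IsLinearProduct : ∀ {k} r (c : Fin k → ℕ) (α : Vec ℕ k) → IsLinearProduct (monomialTerm r c α) (monomialFactors r c α)
monomialTerm-IsLinearProduct r c [] β = refl
monomialTerm-IsLinearProduct r c (a ∷ α) =
  ⊗-IsLinearProduct (L.concat (replicate a (fFactors r (c F.zero)))) _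
    (powP-IsLinearProduct _ (fpoly-IsLinearProduct r (c F.zero)) a)
    (monomialTerm-IsLinearProduct r (c ∘ F.suc) α)

-- the coefficient of a^b in ∏_{c ∈ cs} (c + a)
coeffLin : List ℕ → ℕ → ℕ
coeffLin [] zero = 1
coeffLin [] (suc b) = 0
coeffLin (c ∷ cs) zero = c * coeffLin cs zero
coeffLin (c ∷ cs) (suc b) = c * coeffLin cs (suc b) + coeffLin cs b

-- the coefficient of a^β in ∏ⱼ ∏_{c ∈ G j} (c + aⱼ)
coeffLinVars : ∀ {r} → (Fin r → List ℕ) → Vec ℕ r → ℕ
coeffLinVars G [] = 1
coeffLinVars G (b ∷ β) = coeffLin (G F.zero) b * coeffLinVars (G ∘ F.suc) β

coeffLinVars-cong : ∀ {r} {G slice : Fin r → List ℕ} → (∀ j → G j ≡ slice j) → ∀ β → coeffLinVars G β ≡ coeffLinVars slice β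
coeffLinVars-cong G≗slice [] = refl
coeffLinVars-cong G≗slice (b ∷ β) = cong₂ (λ cs p → coeffLin cs b * p) (G≗slice F.zero) (coeffLinVars-cong (G≗slice ∘ F.suc) β)

coeffLinVars-linear : ∀ {r} (G : Fin r → List ℕ) c (i : Fin r) β →
  coeffLinVars (λ j → if does (i FP.≟ j) then c ∷ G j else G j) β ≡ c * coeffLinVars G β + lowered i β (coeffLinVars G)
coeffLinVars-linear G c F.zero (zero ∷ β) = begin
    c * coeffLin (G F.zero) 0 * coeffLinVars (G ∘ F.suc) β
  ≡⟨ *-assoc c _ _ ⟩
    c * (coeffLin (G F.zero) 0 * coeffLinVars (G ∘ F.suc) β)
  ≡⟨ +-identityʳ _ ⟨
    c * (coeffLin (G F.zero) 0 * coeffLinVars (G ∘ F.suc) β) + 0 ∎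
  where open ≡-Reasoning
coeffLinVars-linear G c F.zero (suc b ∷ β) = begin
    (c * x + y) * p
  ≡⟨ solve 4 (λ c x y p → (c :* x :+ y) :* p := c :* (x :* p) :+ y :* p) refl c x y p ⟩
    c * (x * p) + y * p
  ≡⟨ cong (c * (x * p) +_) (lowered-zero (suc b) β (coeffLinVars G)) ⟨
    c * (x * p) + lowered F.zero (suc b ∷ β) (coeffLinVars G) ∎
  where
  open ≡-Reasoning
  x = coeffLin (G F.zero) (suc b)
  y = coeffLin (G F.zero) b
  p = coeffLinVars (G ∘ F.suc) β
coeffLinVars-linear G c (F.suc i) (b ∷ β) = begin
    x * coeffLinVars (λ j → if does (i FP.≟ j) then c ∷ G (F.suc j) else G (F.suc j)) β
  ≡⟨ cong (x *_) (coeffLinVars-linear (G ∘ F.suc) c i β) ⟩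
    x * (c * p + lowered i β (coeffLinVars (G ∘ F.suc)))
  ≡⟨ solve 4 (λ x c p s → x :* (c :* p :+ s) := c :* (x :* p) :+ x :* s) refl x c p (lowered i β (coeffLinVars (G ∘ F.suc))) ⟩
    c * (x * p) + x * lowered i β (coeffLinVars (G ∘ F.suc))
  ≡⟨ cong (c * (x * p) +_) (lowered-*ˡ i β x (coeffLinVars (G ∘ F.suc))) ⟨
    c * coeffLinVars G (b ∷ β) + lowered (F.suc i) (b ∷ β) (coeffLinVars G) ∎
  where
  open ≡-Reasoning
  x = coeffLin (G F.zero) b
  p = coeffLinVars (G ∘ F.suc) β

constsAt : ∀ {r} → List (ℕ × Fin r) → Fin r → List ℕ
constsAt [] j = []
constsAt ((c , i) ∷ L) j = if does (i FP.≟ j) then c ∷ constsAt L j else constsAt L j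

constP1-coeffLinVars : ∀ {r} (β : Vec ℕ r) → constP 1 β ≡ coeffLinVars (λ _ → []) β
constP1-coeffLinVars [] = refl
constP1-coeffLinVars (zero ∷ β) = trans (constP1-coeffLinVars β) (sym (+-identityʳ _))
constP1-coeffLinVars (suc b ∷ β) = refl

mulLinear-coeffLinVars : ∀ {r} (L : List (ℕ × Fin r)) β → mulLinear L (constP 1) β ≡ coeffLinVars (constsAt L) β
mulLinear-coeffLinVars [] β = constP1-coeffLinVars β
mulLinear-coeffLinVars ((c , i) ∷ L) β = begin
    (linear c i ⊗ mulLinear L (constP 1)) β
  ≡⟨ linear-⊗ c i (mulLinear L (constP 1)) β ⟩
    c * mulLinear L (constP 1) β + lowered i β (mulLinear L (constP 1))
  ≡⟨ cong₂ (λ u v → c * u + v) (mulLinear-coeffLinVars L β) (lowered-cong i β (mulLinear-coeffLinVars L)) ⟩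
    c * coeffLinVars (constsAt L) β + lowered i β (coeffLinVars (constsAt L))
  ≡⟨ coeffLinVars-linear (constsAt L) c i β ⟨
    coeffLinVars (constsAt ((c , i) ∷ L)) β ∎
  where open ≡-Reasoning

constsAt-++ : ∀ {r} (L M : List (ℕ × Fin r)) j → constsAt (L ++ M) j ≡ constsAt L j ++ constsAt M j
constsAt-++ [] M j = refl
constsAt-++ ((c , i) ∷ L) M j with does (i FP.≟ j)
... | true = cong (c ∷_) (constsAt-++ L M j)
... | false = constsAt-++ L M j

constsAt-fFactors : ∀ r x (j : Fin r) → constsAt (fFactors r x) j ≡ x ∷ []
constsAt-fFactors (suc r) x F.zero = cong (x ∷_) (none {r} id)
  where
  none : ∀ {r m} (h : Fin r → Fin m) → constsAt (toList (V.map (x ,_) (tabulate (F.suc ∘ h)))) F.zero ≡ []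
  none {zero} h = refl
  none {suc r} h = none (h ∘ F.suc)
constsAt-fFactors (suc r) x (F.suc j) = trans (shift id j) (constsAt-fFactors r x j)
  where
  shift : ∀ {r m} (h : Fin r → Fin m) j →
    constsAt (toList (V.map (x ,_) (tabulate (F.suc ∘ h)))) (F.suc j) ≡ constsAt (toList (V.map (x ,_) (tabulate h))) j
  shift {zero} h j = refl
  shift {suc r} h j with does (h F.zero FP.≟ j)
  ... | true = cong (x ∷_) (shift (h ∘ F.suc) j)
  ... | false = shift (h ∘ F.suc) j

repeatBy : ∀ {k} → (Fin k → ℕ) → Vec ℕ k → List ℕ
repeatBy c [] = []
repeatBy c (a ∷ α) = replicate a (c F.zero) ++ repeatBy (c ∘ F.suc) α

constsAt-monomialFactors : ∀ {k} r (c : Fin k → ℕ) (α : Vec ℕ k) j → constsAt (monomialFactors r c α) j ≡ repeatBy c α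
constsAt-monomialFactors r c [] j = refl
constsAt-monomialFactors r c (a ∷ α) j = begin
    constsAt (L.concat (replicate a (fFactors r (c F.zero))) ++ monomialFactors r (c ∘ F.suc) α) j
  ≡⟨ constsAt-++ (L.concat (replicate a (fFactors r (c F.zero)))) _ j ⟩
    constsAt (L.concat (replicate a (fFactors r (c F.zero)))) j ++ constsAt (monomialFactors r (c ∘ F.suc) α) j
  ≡⟨ cong₂ _++_ (powers a) (constsAt-monomialFactors r (c ∘ F.suc) α j) ⟩
    replicate a (c F.zero) ++ repeatBy (c ∘ F.suc) α ∎
  where
  open ≡-Reasoning
  powers : ∀ e → constsAt (L.concat (replicate e (fFactors r (c F.zero)))) j ≡ replicate e (c F.zero)
  powers zero = refl
  powers (suc e) = trans (constsAt-++ (fFactors r (c F.zero)) _ j) (cong₂ _++_ (constsAt-fFactors r (c F.zero) j) (powers e))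

coeff-monomialTerm : ∀ {k} r (c : Fin k → ℕ) (α : Vec ℕ k) β → monomialTerm r c α β ≡ coeffLinVars (λ _ → repeatBy c α) β
coeff-monomialTerm r c α β = begin
    monomialTerm r c α β                                       ≡⟨ monomialTerm-IsLinearProduct r c α β ⟩
    mulLinear (monomialFactors r c α) (constP 1) β              ≡⟨ mulLinear-coeffLinVars (monomialFactors r c α) β ⟩
    coeffLinVars (constsAt (monomialFactors r c α)) β           ≡⟨ coeffLinVars-cong (constsAt-monomialFactors r c α) β ⟩
    coeffLinVars (λ _ → repeatBy c α) β ∎
  where open ≡-Reasoning

coeffLin-swap : ∀ x y zs b → coeffLin (x ∷ y ∷ zs) b ≡ coeffLin (y ∷ x ∷ zs) b
coeffLin-swap x y zs zero = solve 3 (λ x y u → x :* (y :* u) := y :* (x :* u)) refl x y (coeffLin zs 0)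
coeffLin-swap x y zs (suc zero) =
  solve 4 (λ x y u v → x :* (y :* u :+ v) :+ y :* v := y :* (x :* u :+ v) :+ x :* v) refl
    x y (coeffLin zs 1) (coeffLin zs 0)
coeffLin-swap x y zs (suc (suc b)) =
  solve 5 (λ x y u v w → x :* (y :* u :+ v) :+ (y :* v :+ w) := y :* (x :* u :+ v) :+ (x :* v :+ w)) refl
    x y (coeffLin zs (suc (suc b))) (coeffLin zs (suc b)) (coeffLin zs b)

coeffLin-∷ : ∀ x {xs ys} → (∀ b → coeffLin xs b ≡ coeffLin ys b) → ∀ b → coeffLin (x ∷ xs) b ≡ coeffLin (x ∷ ys) b
coeffLin-∷ x xs≗ys zero = cong (x *_) (xs≗ys zero)
coeffLin-∷ x xs≗ys (suc b) = cong₂ (λ u v → x * u + v) (xs≗ys (suc b)) (xs≗ys b)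

coeffLin-↭ : ∀ {xs ys} → xs ↭ ys → ∀ b → coeffLin xs b ≡ coeffLin ys b
coeffLin-↭ Perm.refl b = refl
coeffLin-↭ (prep x p) = coeffLin-∷ x (coeffLin-↭ p)
coeffLin-↭ {x ∷ y ∷ xs} (swap x y p) b = trans (coeffLin-swap x y xs b) (coeffLin-∷ y (coeffLin-∷ x (coeffLin-↭ p)) b)
coeffLin-↭ (Perm.trans p q) b = trans (coeffLin-↭ p b) (coeffLin-↭ q b)

coeffLinVars-↭ : ∀ {r} {xs ys} → xs ↭ ys → (β : Vec ℕ r) → coeffLinVars (λ _ → xs) β ≡ coeffLinVars (λ _ → ys) β
coeffLinVars-↭ p [] = refl
coeffLinVars-↭ p (b ∷ β) = cong₂ _*_ (coeffLin-↭ p b) (coeffLinVars-↭ p β)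

-- Counting the sequences s₁, …, s_r above a fixed s₀

seqs : ℕ → (m : ℕ) → List (Vec ℕ m)
seqs k m = vecsFrom (upTo (suc (suc k))) m

admissible : ∀ {n} → ℕ → Vec ℕ n → Vec ℕ n → ℕ → Bool
admissible k s₀ s b = vleq s₀ s ∧ vleqN s (suc k) ∧ (countOcc (suc k) (toList s) ≡ᵇ b)

#admissible : ∀ {n} → ℕ → Vec ℕ n → ℕ → ℕ
#admissible {n} k s₀ b = length (filterB (λ s → admissible k s₀ s b) (seqs k n))

sumL-upTo-threshold : ∀ x A m → sumL (L.map (λ h → if x ≤ᵇ h then A else 0) (upTo m)) ≡ (m ∸ x) * A
sumL-upTo-threshold x A zero = cong (_* A) (sym (0∸n≡0 x))
sumL-upTo-threshold x A (suc m) = begin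
    sumL (L.map (λ h → if x ≤ᵇ h then A else 0) (upTo (suc m)))
  ≡⟨ sumL-map-upTo-suc _ m ⟩
    sumL (L.map (λ h → if x ≤ᵇ h then A else 0) (upTo m)) + (if x ≤ᵇ m then A else 0)
  ≡⟨ cong (_+ (if x ≤ᵇ m then A else 0)) (sumL-upTo-threshold x A m) ⟩
    (m ∸ x) * A + (if x ≤ᵇ m then A else 0)
  ≡⟨ last-term (x ≤? m) ⟩
    (suc m ∸ x) * A ∎
  where
  open ≡-Reasoning
  last-term : Dec (x ≤ m) → (m ∸ x) * A + (if x ≤ᵇ m then A else 0) ≡ (suc m ∸ x) * A
  last-term (yes x≤m) rewrite dec-true (x ≤? m) x≤m | +-∸-assoc 1 x≤m = +-comm _ A
  last-term (no x≰m) rewrite dec-false (x ≤? m) x≰m | m≤n⇒m∸n≡0 (≰⇒≥ x≰m) | m≤n⇒m∸n≡0 (≰⇒> x≰m) = refl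

module _ (k : ℕ) {n} (x : ℕ) (s₀ : Vec ℕ n) where

  #admissibleWithHead : ℕ → ℕ → ℕ
  #admissibleWithHead b h = length (filterB (λ t → admissible k (x ∷ s₀) (h ∷ t) b) (seqs k n))

  #admissibleWithHead-≤ : ∀ b {h} → h ≤ k → #admissibleWithHead b h ≡ (if x ≤ᵇ h then #admissible k s₀ b else 0)
  #admissibleWithHead-≤ b {h} h≤k = trans (cong length (filterB-cong reorder (seqs k n))) (length-filterB-∧ (x ≤ᵇ h) _ (seqs k n))
    where
    h≢1+k : suc k ≢ h
    h≢1+k 1+k≡h = 1+n≰n (subst (_≤ k) (sym 1+k≡h) h≤k)
    ∧-reorder : ∀ a v w z → (a ∧ v) ∧ ((true ∧ w) ∧ z) ≡ a ∧ (v ∧ (w ∧ z))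
    ∧-reorder true v w z = refl
    ∧-reorder false v w z = refl
    reorder : ∀ t → admissible k (x ∷ s₀) (h ∷ t) b ≡ ((x ≤ᵇ h) ∧ admissible k s₀ t b)
    reorder t
      rewrite dec-true (h ≤? suc k) (m≤n⇒m≤1+n h≤k)
            | LP.filter-reject (suc k ≟_) {h} {toList t} h≢1+k
      = ∧-reorder (x ≤ᵇ h) (vleq s₀ t) (vleqN t (suc k)) _

  #admissibleWithHead-1+k : ∀ b → x ≤ k →
    #admissibleWithHead b (suc k) ≡ length (filterB (λ t → vleq s₀ t ∧ vleqN t (suc k) ∧ (suc (countOcc (suc k) (toList t)) ≡ᵇ b)) (seqs k n))
  #admissibleWithHead-1+k b x≤k = cong length (filterB-cong simplify (seqs k n))
    where
    simplify : ∀ t → admissible k (x ∷ s₀) (suc k ∷ t) b ≡ (vleq s₀ t ∧ vleqN t (suc k) ∧ (suc (countOcc (suc k) (toList t)) ≡ᵇ b))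
    simplify t
      rewrite dec-true (x ≤? suc k) (m≤n⇒m≤1+n x≤k)
            | dec-true (suc k ≤? suc k) (≤-refl {suc k})
            | LP.filter-accept (suc k ≟_) {suc k} {toList t} refl
      = refl

  #admissibleWithHead-1+k-zero : x ≤ k → #admissibleWithHead 0 (suc k) ≡ 0
  #admissibleWithHead-1+k-zero x≤k = begin
      #admissibleWithHead 0 (suc k)
    ≡⟨ #admissibleWithHead-1+k 0 x≤k ⟩
      length (filterB (λ t → vleq s₀ t ∧ vleqN t (suc k) ∧ false) (seqs k n))
    ≡⟨ cong length (filterB-cong (λ t → ∧-false (vleq s₀ t) (vleqN t (suc k))) (seqs k n)) ⟩
      length (filterB (λ _ → false) (seqs k n))
    ≡⟨ length-filterB-∧ false (λ _ → true) (seqs k n) ⟩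
      0 ∎
    where
    open ≡-Reasoning
    ∧-false : ∀ v w → v ∧ (w ∧ false) ≡ false
    ∧-false true true = refl
    ∧-false true false = refl
    ∧-false false w = refl

  #admissible-∷ : ∀ b → x ≤ k → #admissible k (x ∷ s₀) b ≡ (suc k ∸ x) * #admissible k s₀ b + #admissibleWithHead b (suc k)
  #admissible-∷ b x≤k = begin
      #admissible k (x ∷ s₀) b
    ≡⟨ length-filterB-cartesianProductWith (λ s → admissible k (x ∷ s₀) s b) _∷_ (upTo (suc (suc k))) (seqs k n) ⟩
      sumL (L.map (#admissibleWithHead b) (upTo (suc (suc k))))
    ≡⟨ sumL-map-upTo-suc (#admissibleWithHead b) (suc k) ⟩
      sumL (L.map (#admissibleWithHead b) (upTo (suc k))) + #admissibleWithHead b (suc k)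
    ≡⟨ cong (λ l → sumL l + #admissibleWithHead b (suc k)) (LP.map-cong-local below-1+k) ⟩
      sumL (L.map (λ h → if x ≤ᵇ h then #admissible k s₀ b else 0) (upTo (suc k))) + #admissibleWithHead b (suc k)
    ≡⟨ cong (_+ #admissibleWithHead b (suc k)) (sumL-upTo-threshold x (#admissible k s₀ b) (suc k)) ⟩
      (suc k ∸ x) * #admissible k s₀ b + #admissibleWithHead b (suc k) ∎
    where
    open ≡-Reasoning
    below-1+k : All (λ h → #admissibleWithHead b h ≡ (if x ≤ᵇ h then #admissible k s₀ b else 0)) (upTo (suc k))
    below-1+k = All.tabulate (λ h∈ → #admissibleWithHead-≤ b (≤-pred (MP.∈-upTo⁻ h∈)))

-- each position p of s is k + 1 or one of the k + 1 - s₀ₚ values in [s₀ₚ, k]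
#admissible-coeffLin : ∀ k {n} (s₀ : Vec ℕ n) → All (_≤ k) (toList s₀) →
  ∀ b → #admissible k s₀ b ≡ coeffLin (L.map (suc k ∸_) (toList s₀)) b
#admissible-coeffLin k [] _ zero = refl
#admissible-coeffLin k [] _ (suc b) = refl
#admissible-coeffLin k (x ∷ s₀) (x≤k ∷ s₀≤k) zero = begin
    #admissible k (x ∷ s₀) 0
  ≡⟨ #admissible-∷ k x s₀ 0 x≤k ⟩
    (suc k ∸ x) * #admissible k s₀ 0 + #admissibleWithHead k x s₀ 0 (suc k)
  ≡⟨ cong₂ (λ u v → (suc k ∸ x) * u + v) (#admissible-coeffLin k s₀ s₀≤k 0) (#admissibleWithHead-1+k-zero k x s₀ x≤k) ⟩
    (suc k ∸ x) * coeffLin (L.map (suc k ∸_) (toList s₀)) 0 + 0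
  ≡⟨ +-identityʳ _ ⟩
    coeffLin (L.map (suc k ∸_) (toList (x ∷ s₀))) 0 ∎
  where open ≡-Reasoning
#admissible-coeffLin k (x ∷ s₀) (x≤k ∷ s₀≤k) (suc b) = begin
    #admissible k (x ∷ s₀) (suc b)
  ≡⟨ #admissible-∷ k x s₀ (suc b) x≤k ⟩
    (suc k ∸ x) * #admissible k s₀ (suc b) + #admissibleWithHead k x s₀ (suc b) (suc k)
  ≡⟨ cong₂ (λ u v → (suc k ∸ x) * u + v) (#admissible-coeffLin k s₀ s₀≤k (suc b))
       (trans (#admissibleWithHead-1+k k x s₀ (suc b) x≤k) (#admissible-coeffLin k s₀ s₀≤k b)) ⟩
    coeffLin (L.map (suc k ∸_) (toList (x ∷ s₀))) (suc b) ∎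
  where open ≡-Reasoning

#admissibleTuples : ∀ {n r} → ℕ → Vec ℕ n → Vec ℕ r → ℕ
#admissibleTuples {n} {r} k s₀ β =
  length (filterB (λ ss → and (toList (zipWith (λ sᵢ βᵢ → admissible k s₀ sᵢ βᵢ) ss β))) (vecsFrom (seqs k n) r))

#admissibleTuples-coeffLinVars : ∀ k {n r} (s₀ : Vec ℕ n) → All (_≤ k) (toList s₀) → (β : Vec ℕ r) →
  #admissibleTuples k s₀ β ≡ coeffLinVars (λ _ → L.map (suc k ∸_) (toList s₀)) β
#admissibleTuples-coeffLinVars k s₀ s₀≤k [] = refl
#admissibleTuples-coeffLinVars k {n} {suc r} s₀ s₀≤k (b ∷ β) = begin
    #admissibleTuples k s₀ (b ∷ β)
  ≡⟨ length-filterB-cartesianProductWith _ _∷_ (seqs k n) (vecsFrom (seqs k n) r) ⟩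
    sumL (L.map (λ s → length (filterB (λ ss → admissible k s₀ s b ∧ rest ss) (vecsFrom (seqs k n) r))) (seqs k n))
  ≡⟨ sumL-map-cong (λ s → length-filterB-∧ (admissible k s₀ s b) rest (vecsFrom (seqs k n) r)) (seqs k n) ⟩
    sumL (L.map (λ s → if admissible k s₀ s b then #admissibleTuples k s₀ β else 0) (seqs k n))
  ≡⟨ sumL-map-if-const (λ s → admissible k s₀ s b) (#admissibleTuples k s₀ β) (seqs k n) ⟩
    #admissible k s₀ b * #admissibleTuples k s₀ β
  ≡⟨ cong₂ _*_ (#admissible-coeffLin k s₀ s₀≤k b) (#admissibleTuples-coeffLinVars k s₀ s₀≤k β) ⟩
    coeffLinVars (λ _ → L.map (suc k ∸_) (toList s₀)) (b ∷ β) ∎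
  where
  open ≡-Reasoning
  rest = λ ss → and (toList (zipWith (λ sᵢ βᵢ → admissible k s₀ sᵢ βᵢ) ss β))

countTuples-sumL : ∀ r λs k (β : Vec ℕ r) →
  countTuples r λs k β ≡ sumL (L.map (λ s₀ → #admissibleTuples k s₀ β) (filterB (inS λs k) (seqs k (sumList λs))))
countTuples-sumL r λs k β = begin
    countTuples r λs k β
  ≡⟨ length-filterB-cartesianProductWith (goodTuple λs k β) _,_ (seqs k n) (vecsFrom (seqs k n) r) ⟩
    sumL (L.map (λ s₀ → length (filterB (λ ss → inS λs k s₀ ∧ _) (vecsFrom (seqs k n) r))) (seqs k n))
  ≡⟨ sumL-map-cong (λ s₀ → length-filterB-∧ (inS λs k s₀) _ (vecsFrom (seqs k n) r)) (seqs k n) ⟩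
    sumL (L.map (λ s₀ → if inS λs k s₀ then #admissibleTuples k s₀ β else 0) (seqs k n))
  ≡⟨ sumL-map-filterB (inS λs k) (λ s₀ → #admissibleTuples k s₀ β) (seqs k n) ⟨
    sumL (L.map (λ s₀ → #admissibleTuples k s₀ β) (filterB (inS λs k) (seqs k n))) ∎
  where
  open ≡-Reasoning
  n = sumList λs

Unique-map : ∀ {X Y : Set} (f : Y → X) {l : List Y} → (∀ {a b} → a ∈ l → b ∈ l → f a ≡ f b → a ≡ b) → Unique l → Unique (L.map f l)
Unique-map f {[]} _ [] = []
Unique-map f {y ∷ l} inj (y∉l ∷ u) =
  AllP.map⁺ (All.tabulate (λ {z} z∈ fy≡fz → All.lookup y∉l z∈ (inj (here refl) (there z∈) fy≡fz)))
  ∷ Unique-map f (λ a∈ b∈ → inj (there a∈) (there b∈)) u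

module Multiplicity {X : Set} (_≟X_ : DecidableEquality X) where

  mult : X → List X → ℕ
  mult v xs = length (filter (v ≟X_) xs)

  mult-here : ∀ v xs → mult v (v ∷ xs) ≡ suc (mult v xs)
  mult-here v xs = cong length (LP.filter-accept (v ≟X_) {v} {xs} refl)

  mult-there : ∀ {v x} → v ≢ x → ∀ xs → mult v (x ∷ xs) ≡ mult v xs
  mult-there {v} {x} v≢x xs = cong length (LP.filter-reject (v ≟X_) {x} {xs} v≢x)

  mult-++ : ∀ v xs ys → mult v (xs ++ ys) ≡ mult v xs + mult v ys
  mult-++ v xs ys = trans (cong length (LP.filter-++ (v ≟X_) xs ys)) (LP.length-++ (filter (v ≟X_) xs))

  mult-↭ : ∀ v {xs ys} → xs ↭ ys → mult v xs ≡ mult v ys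
  mult-↭ v p = PP.↭-length (PP.filter-↭ (v ≟X_) p)

  mult-suc⇒∈ : ∀ v xs {m} → mult v xs ≡ suc m → v ∈ xs
  mult-suc⇒∈ v (x ∷ xs) eq with v ≟X x
  ... | yes refl = here refl
  ... | no _ = there (mult-suc⇒∈ v xs eq)

  mult-∉ : ∀ v xs → v ∉ xs → mult v xs ≡ 0
  mult-∉ v xs v∉xs with mult v xs in eq
  ... | zero = refl
  ... | suc m = ⊥-elim (v∉xs (mult-suc⇒∈ v xs eq))

  Unique⇒mult≡1 : ∀ {v xs} → Unique xs → v ∈ xs → mult v xs ≡ 1
  Unique⇒mult≡1 {v} {x ∷ xs} (x∉xs ∷ _) (here refl) = trans (mult-here v xs) (cong suc (mult-∉ v xs (λ v∈ → All.lookup x∉xs v∈ refl)))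
  Unique⇒mult≡1 {v} {x ∷ xs} (x∉xs ∷ u) (there v∈) = trans (mult-there (λ v≡x → All.lookup x∉xs v∈ (sym v≡x)) xs) (Unique⇒mult≡1 u v∈)

  mult⇒↭ : ∀ xs ys → (∀ v → mult v xs ≡ mult v ys) → xs ↭ ys
  mult⇒↭ [] [] _ = ↭-refl
  mult⇒↭ [] (y ∷ ys) eq = ⊥-elim (0≢1+n (trans (eq y) (mult-here y ys)))
  mult⇒↭ (x ∷ xs) ys eq with MP.∈-∃++ (mult-suc⇒∈ x ys (trans (sym (eq x)) (mult-here x xs)))
  ... | as , bs , refl = ↭-trans (prep x (mult⇒↭ xs (as ++ bs) eq′)) (↭-sym (PP.shift x as bs))
    where
    eq′ : ∀ v → mult v xs ≡ mult v (as ++ bs)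
    eq′ v with v ≟X x
    ... | yes refl = suc-injective (trans (sym (mult-here v xs)) (trans (eq v) (trans (mult-↭ v (PP.shift v as bs)) (mult-here v (as ++ bs)))))
    ... | no v≢x = trans (sym (mult-there v≢x xs)) (trans (eq v) (trans (mult-↭ v (PP.shift x as bs)) (mult-there v≢x (as ++ bs))))

  map-filterB-↭ : ∀ {Y : Set} (xs : List X) (ys : List Y) (p : X → Bool) (q : Y → Bool) (ψ : Y → X) →
    Unique xs → Unique ys →
    (∀ {y y′} → y ∈ ys → q y ≡ true → y′ ∈ ys → q y′ ≡ true → ψ y ≡ ψ y′ → y ≡ y′) →
    (∀ {y} → y ∈ ys → q y ≡ true → ψ y ∈ xs × p (ψ y) ≡ true) →
    (∀ {x} → x ∈ xs → p x ≡ true → Σ Y (λ y → y ∈ ys × q y ≡ true × ψ y ≡ x)) →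
    L.map ψ (filterB q ys) ↭ filterB p xs
  map-filterB-↭ xs ys p q ψ uxs uys inj into onto = mult⇒↭ _ _ same-mult
    where
    open DecMembership _≟X_ using (_∈?_)
    uimage : Unique (L.map ψ (filterB q ys))
    uimage = Unique-map ψ
      (λ a∈ b∈ → let (a∈ys , qa) = ∈-filterB⁻ q ys a∈ ; (b∈ys , qb) = ∈-filterB⁻ q ys b∈ in inj a∈ys qa b∈ys qb)
      (Unique-filterB q uys)
    same-mult : ∀ v → mult v (L.map ψ (filterB q ys)) ≡ mult v (filterB p xs)
    same-mult v with v ∈? filterB p xs
    ... | yes v∈ = trans (Unique⇒mult≡1 uimage in-image) (sym (Unique⇒mult≡1 (Unique-filterB p uxs) v∈))
      where
      in-image : v ∈ L.map ψ (filterB q ys)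
      in-image with onto (proj₁ (∈-filterB⁻ p xs v∈)) (proj₂ (∈-filterB⁻ p xs v∈))
      ... | y , y∈ , qy , refl = MP.∈-map⁺ ψ (∈-filterB⁺ q y∈ qy)
    ... | no v∉ = trans (mult-∉ v _ not-in-image) (sym (mult-∉ v _ v∉))
      where
      not-in-image : v ∉ L.map ψ (filterB q ys)
      not-in-image v∈ with MP.∈-map⁻ ψ v∈
      ... | y , y∈ , refl = let (y∈ys , qy) = ∈-filterB⁻ q ys y∈ ; (ψy∈ , pψy) = into y∈ys qy in v∉ (∈-filterB⁺ p ψy∈ pψy)

-- Weakly increasing sequences with prescribed multiplicities

open Multiplicity _≟_ using (mult-++; mult-↭; mult-∉; mult⇒↭)

≡true⇒T : ∀ {b} → b ≡ true → T b
≡true⇒T refl = _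

sameMultiset⇒countOcc : ∀ xs ys → sameMultiset xs ys ≡ true → ∀ v → countOcc v xs ≡ countOcc v ys
sameMultiset⇒countOcc xs ys h v with DecMembership._∈?_ _≟_ v (xs ++ ys)
... | yes v∈ = ≡ᵇ⇒≡ _ _ (≡true⇒T (All.lookup (all-true⁻ _ (xs ++ ys) h) v∈))
... | no v∉ = trans (mult-∉ v xs (v∉ ∘ MP.∈-++⁺ˡ)) (sym (mult-∉ v ys (v∉ ∘ MP.∈-++⁺ʳ xs)))

countOcc⇒sameMultiset : ∀ xs ys → (∀ v → countOcc v xs ≡ countOcc v ys) → sameMultiset xs ys ≡ true
countOcc⇒sameMultiset xs ys eq = all-true⁺ _ (xs ++ ys) (All.tabulate (λ {v} _ → dec-true (countOcc v xs ≟ countOcc v ys) (eq v)))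

sameMultiset-↭ˡ : ∀ {xs xs′} ys → xs ↭ xs′ → sameMultiset xs ys ≡ true → sameMultiset xs′ ys ≡ true
sameMultiset-↭ˡ {xs} {xs′} ys p h = countOcc⇒sameMultiset xs′ ys (λ v → trans (sym (mult-↭ v p)) (sameMultiset⇒countOcc xs ys h v))

sameMultiset⇒↭ : ∀ xs ys → sameMultiset xs ys ≡ true → xs ↭ ys
sameMultiset⇒↭ xs ys h = mult⇒↭ xs ys (sameMultiset⇒countOcc xs ys h)

countOcc-none : ∀ v l → All (v ≢_) l → countOcc v l ≡ 0
countOcc-none v l v∉ = mult-∉ v l (λ v∈ → All.lookup v∉ v∈ refl)

countOcc-replicate : ∀ v a → countOcc v (replicate a v) ≡ a
countOcc-replicate v zero = refl
countOcc-replicate v (suc a) = trans (cong length (LP.filter-accept (v ≟_) {v} {replicate a v} refl)) (cong suc (countOcc-replicate v a))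

weaklyIncreasing⇒Linked : ∀ xs → weaklyIncreasing xs ≡ true → Linked _≤_ xs
weaklyIncreasing⇒Linked [] _ = []
weaklyIncreasing⇒Linked (x ∷ []) _ = [-]
weaklyIncreasing⇒Linked (x ∷ y ∷ xs) h =
  ≤ᵇ⇒≤ x y (≡true⇒T (proj₁ (∧-true⁻ h))) ∷ weaklyIncreasing⇒Linked (y ∷ xs) (proj₂ (∧-true⁻ {x ≤ᵇ y} h))

weaklyIncreasing-↭⇒≡ : ∀ {xs ys} → weaklyIncreasing xs ≡ true → weaklyIncreasing ys ≡ true → xs ↭ ys → xs ≡ ys
weaklyIncreasing-↭⇒≡ {xs} {ys} xs↗ ys↗ p =
  Pointwise-≡⇒≡ (↗↭↗⇒≋ ≤-totalOrder (weaklyIncreasing⇒Linked xs xs↗) (weaklyIncreasing⇒Linked ys ys↗) (↭⇒↭ₛ p))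

weaklyIncreasing-replicate : ∀ a m → weaklyIncreasing (replicate a m) ≡ true
weaklyIncreasing-replicate zero m = refl
weaklyIncreasing-replicate (suc zero) m = refl
weaklyIncreasing-replicate (suc (suc a)) m = ∧-true⁺ (dec-true (m ≤? m) ≤-refl) (weaklyIncreasing-replicate (suc a) m)

weaklyIncreasing-++-replicate : ∀ xs a m → weaklyIncreasing xs ≡ true → All (_≤ m) xs → weaklyIncreasing (xs ++ replicate a m) ≡ true
weaklyIncreasing-++-replicate [] a m _ _ = weaklyIncreasing-replicate a m
weaklyIncreasing-++-replicate (x ∷ []) zero m _ _ = refl
weaklyIncreasing-++-replicate (x ∷ []) (suc a) m _ (x≤m ∷ []) = ∧-true⁺ (dec-true (x ≤? m) x≤m) (weaklyIncreasing-replicate (suc a) m)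
weaklyIncreasing-++-replicate (x ∷ y ∷ xs) a m h (_ ∷ ≤m) =
  ∧-true⁺ (proj₁ (∧-true⁻ h)) (weaklyIncreasing-++-replicate (y ∷ xs) a m (proj₂ (∧-true⁻ {x ≤ᵇ y} h)) ≤m)

-- the weakly increasing sequence in which k - j occurs αⱼ times
fromMultiplicities : ∀ {k} → Vec ℕ k → List ℕ
fromMultiplicities [] = []
fromMultiplicities {suc k} (a ∷ α) = fromMultiplicities α ++ replicate a (suc k)

InRange : ℕ → ℕ → Set
InRange k x = 1 ≤ x × x ≤ k

fromMultiplicities-InRange : ∀ {k} (α : Vec ℕ k) → All (InRange k) (fromMultiplicities α)
fromMultiplicities-InRange [] = []
fromMultiplicities-InRange {suc k} (a ∷ α) =
  AllP.++⁺ (All.map (map₂ m≤n⇒m≤1+n) (fromMultiplicities-InRange α)) (AllP.replicate⁺ a (s≤s z≤n , ≤-refl))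

fromMultiplicities-weaklyIncreasing : ∀ {k} (α : Vec ℕ k) → weaklyIncreasing (fromMultiplicities α) ≡ true
fromMultiplicities-weaklyIncreasing [] = refl
fromMultiplicities-weaklyIncreasing {suc k} (a ∷ α) =
  weaklyIncreasing-++-replicate (fromMultiplicities α) a (suc k) (fromMultiplicities-weaklyIncreasing α)
    (All.map (m≤n⇒m≤1+n ∘ proj₂) (fromMultiplicities-InRange α))

countOcc-fromMultiplicities : ∀ {k} (α : Vec ℕ k) j → countOcc (k ∸ toℕ j) (fromMultiplicities α) ≡ lookup α j
countOcc-fromMultiplicities {suc k} (a ∷ α) F.zero = begin
    countOcc (suc k) (fromMultiplicities α ++ replicate a (suc k))
  ≡⟨ mult-++ (suc k) (fromMultiplicities α) _ ⟩
    countOcc (suc k) (fromMultiplicities α) + countOcc (suc k) (replicate a (suc k))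
  ≡⟨ cong₂ _+_ (countOcc-none (suc k) _ (All.map (λ (_ , x≤k) 1+k≡x → 1+n≰n (subst (_≤ k) (sym 1+k≡x) x≤k)) (fromMultiplicities-InRange α)))
               (countOcc-replicate (suc k) a) ⟩
    a ∎
  where open ≡-Reasoning
countOcc-fromMultiplicities {suc k} (a ∷ α) (F.suc j) = begin
    countOcc (k ∸ toℕ j) (fromMultiplicities α ++ replicate a (suc k))
  ≡⟨ mult-++ (k ∸ toℕ j) (fromMultiplicities α) _ ⟩
    countOcc (k ∸ toℕ j) (fromMultiplicities α) + countOcc (k ∸ toℕ j) (replicate a (suc k))
  ≡⟨ cong₂ _+_ (countOcc-fromMultiplicities α j)
               (countOcc-none (k ∸ toℕ j) _ (AllP.replicate⁺ a (λ eq → 1+n≰n (subst (_≤ k) eq (m∸n≤m k (toℕ j)))))) ⟩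
    lookup α j + 0
  ≡⟨ +-identityʳ _ ⟩
    lookup α j ∎
  where open ≡-Reasoning

length-fromMultiplicities : ∀ {k} (α : Vec ℕ k) → length (fromMultiplicities α) ≡ sumL (toList α)
length-fromMultiplicities [] = refl
length-fromMultiplicities {suc k} (a ∷ α) =
  trans (LP.length-++ (fromMultiplicities α)) (trans (cong₂ _+_ (length-fromMultiplicities α) (LP.length-replicate a)) (+-comm _ a))

All-toList-tabulate : ∀ {k} {P : ℕ → Set} (f : Fin k → ℕ) → (∀ j → P (f j)) → All P (toList (tabulate f))
All-toList-tabulate {zero} f Pf = []
All-toList-tabulate {suc k} f Pf = Pf F.zero ∷ All-toList-tabulate (f ∘ F.suc) (Pf ∘ F.suc)

toList-tabulate-reverse-↭ : ∀ k (g : ℕ → ℕ) → toList (tabulate {n = k} (λ j → g (k ∸ toℕ j))) ↭ L.map (g ∘ suc) (upTo k)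
toList-tabulate-reverse-↭ zero g = ↭-refl
toList-tabulate-reverse-↭ (suc k) g = begin
    g (suc k) ∷ toList (tabulate {n = k} (λ j → g (k ∸ toℕ j)))   ↭⟨ prep (g (suc k)) (toList-tabulate-reverse-↭ k g) ⟩
    g (suc k) ∷ L.map (g ∘ suc) (upTo k)                          ↭⟨ PP.++-comm (g (suc k) ∷ []) (L.map (g ∘ suc) (upTo k)) ⟩
    L.map (g ∘ suc) (upTo k) ++ g (suc k) ∷ []                    ≡⟨ LP.map-++ (g ∘ suc) (upTo k) (k ∷ []) ⟨
    L.map (g ∘ suc) (upTo k L.∷ʳ k)                               ≡⟨ cong (L.map (g ∘ suc)) (LP.upTo-∷ʳ k) ⟩
    L.map (g ∘ suc) (upTo (suc k)) ∎
  where open Perm.PermutationReasoning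

∈-vecsFrom : ∀ (U : List ℕ) {m} (v : Vec ℕ m) → All (_∈ U) (toList v) → v ∈ vecsFrom U m
∈-vecsFrom U [] _ = here refl
∈-vecsFrom U (x ∷ v) (x∈U ∷ v∈U) = MP.∈-cartesianProductWith⁺ _∷_ x∈U (∈-vecsFrom U v v∈U)

Unique-vecsFrom : ∀ (U : List ℕ) m → Unique U → Unique (vecsFrom U m)
Unique-vecsFrom U zero _ = [] ∷ []
Unique-vecsFrom U (suc m) u = UniqueP.cartesianProductWith⁺ _∷_ VP.∷-injective u (Unique-vecsFrom U m u)

inRange⁻ : ∀ k l → all (λ x → (1 ≤ᵇ x) ∧ (x ≤ᵇ k)) l ≡ true → All (InRange k) l
inRange⁻ k l h = All.map bounds (all-true⁻ _ l h)
  where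
  bounds : ∀ {x} → (1 ≤ᵇ x) ∧ (x ≤ᵇ k) ≡ true → InRange k x
  bounds {x} e = ≤ᵇ⇒≤ 1 x (≡true⇒T (proj₁ (∧-true⁻ e))) , ≤ᵇ⇒≤ x k (≡true⇒T (proj₂ (∧-true⁻ {1 ≤ᵇ x} e)))

inRange⁺ : ∀ k l → All (InRange k) l → all (λ x → (1 ≤ᵇ x) ∧ (x ≤ᵇ k)) l ≡ true
inRange⁺ k l inR = all-true⁺ _ l (All.map (λ {x} (1≤x , x≤k) → ∧-true⁺ (dec-true (1 ≤? x) 1≤x) (dec-true (x ≤? k) x≤k)) inR)

sumL-padded : ∀ λs k → sumL (padded λs k) ≡ sumList λs
sumL-padded λs k = trans (sum-++ λs _) (trans (cong (sumList λs +_) (zeros (k ∸ length λs))) (+-identityʳ _))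
  where
  zeros : ∀ m → sumL (replicate m 0) ≡ 0
  zeros zero = refl
  zeros (suc m) = zeros m

module MultiplicityBijection (λs : List ℕ) (k : ℕ) where

  n = sumList λs

  multiplicities : Vec ℕ n → Vec ℕ k
  multiplicities s = tabulate (λ j → countOcc (k ∸ toℕ j) (toList s))

  rearrangements : List (Vec ℕ k)
  rearrangements = filterB (λ α → sameMultiset (toList α) (padded λs k)) (vecsFrom (upTo (suc n)) k)

  S : List (Vec ℕ n)
  S = filterB (inS λs k) (seqs k n)

  record InS (s : Vec ℕ n) : Set where
    field
      increasing : weaklyIncreasing (toList s) ≡ true
      inRange : All (InRange k) (toList s)
      sameParts : sameMultiset (L.map (λ i → countOcc (suc i) (toList s)) (upTo k)) (padded λs k) ≡ true

  inS⁻ : ∀ s → inS λs k s ≡ true → InS s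
  inS⁻ s h = record
    { increasing = proj₁ (∧-true⁻ h)
    ; inRange = inRange⁻ k (toList s) (proj₁ (∧-true⁻ (proj₂ (∧-true⁻ {weaklyIncreasing (toList s)} h))))
    ; sameParts = proj₂ (∧-true⁻ {all (λ x → (1 ≤ᵇ x) ∧ (x ≤ᵇ k)) (toList s)} (proj₂ (∧-true⁻ {weaklyIncreasing (toList s)} h)))
    }

  multiplicities-↭ : ∀ l → toList (tabulate (λ (j : Fin k) → countOcc (k ∸ toℕ j) l)) ↭ L.map (λ i → countOcc (suc i) l) (upTo k)
  multiplicities-↭ l = toList-tabulate-reverse-↭ k (λ v → countOcc v l)

  fromMultiplicities∘multiplicities : ∀ s → InS s → toList s ≡ fromMultiplicities (multiplicities s)
  fromMultiplicities∘multiplicities s s∈S =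
    weaklyIncreasing-↭⇒≡ (InS.increasing s∈S) (fromMultiplicities-weaklyIncreasing (multiplicities s)) (mult⇒↭ _ _ same)
    where
    l = toList s
    absent : ∀ v → ¬ InRange k v → ∀ xs → All (InRange k) xs → countOcc v xs ≡ 0
    absent v v∉ xs inR = countOcc-none v xs (All.map (λ x∈ v≡x → v∉ (subst (InRange k) (sym v≡x) x∈)) inR)
    outside : ∀ v → ¬ InRange k v → countOcc v l ≡ countOcc v (fromMultiplicities (multiplicities s))
    outside v v∉ = trans (absent v v∉ l (InS.inRange s∈S)) (sym (absent v v∉ _ (fromMultiplicities-InRange (multiplicities s))))
    same : ∀ v → countOcc v l ≡ countOcc v (fromMultiplicities (multiplicities s))
    same v with 1 ≤? v | v ≤? k
    ... | yes 1≤v | yes v≤k = begin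
          countOcc v l                                            ≡⟨ cong (λ z → countOcc z l) k∸j≡v ⟨
          countOcc (k ∸ toℕ j) l                                  ≡⟨ VP.lookup∘tabulate (λ j → countOcc (k ∸ toℕ j) l) j ⟨
          lookup (multiplicities s) j                              ≡⟨ countOcc-fromMultiplicities (multiplicities s) j ⟨
          countOcc (k ∸ toℕ j) (fromMultiplicities (multiplicities s)) ≡⟨ cong (λ z → countOcc z (fromMultiplicities (multiplicities s))) k∸j≡v ⟩
          countOcc v (fromMultiplicities (multiplicities s)) ∎
      where
      open ≡-Reasoning
      k∸v<k : k ∸ v < k
      k∸v<k = ∸-monoʳ-< 1≤v v≤k
      j : Fin k
      j = F.fromℕ< k∸v<k
      k∸j≡v : k ∸ toℕ j ≡ v
      k∸j≡v = trans (cong (k ∸_) (FP.toℕ-fromℕ< k∸v<k)) (m∸[m∸n]≡n v≤k)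
    ... | no 1≰v | _ = outside v (1≰v ∘ proj₁)
    ... | yes _ | no v≰k = outside v (v≰k ∘ proj₂)

  multiplicities-rearrangement : ∀ {s} → s ∈ seqs k n → inS λs k s ≡ true →
    multiplicities s ∈ vecsFrom (upTo (suc n)) k × sameMultiset (toList (multiplicities s)) (padded λs k) ≡ true
  multiplicities-rearrangement {s} _ h =
      ∈-vecsFrom _ (multiplicities s) (All-toList-tabulate _ (λ j → MP.∈-upTo⁺ (s≤s (countOcc≤n (k ∸ toℕ j)))))
    , sameMultiset-↭ˡ (padded λs k) (↭-sym (multiplicities-↭ (toList s))) (InS.sameParts (inS⁻ s h))
    where
    countOcc≤n : ∀ v → countOcc v (toList s) ≤ n
    countOcc≤n v = ≤-trans (LP.length-filter (v ≟_) (toList s)) (≤-reflexive (VP.length-toList s))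

  multiplicities-injective : ∀ {s s′} → s ∈ seqs k n → inS λs k s ≡ true → s′ ∈ seqs k n → inS λs k s′ ≡ true →
    multiplicities s ≡ multiplicities s′ → s ≡ s′
  multiplicities-injective {s} {s′} _ h _ h′ eq =
    trans (sym (VCast.cast-is-id refl s))
      (VP.toList-injective refl s s′ (trans (fromMultiplicities∘multiplicities s (inS⁻ s h))
        (trans (cong fromMultiplicities eq) (sym (fromMultiplicities∘multiplicities s′ (inS⁻ s′ h′))))))

  multiplicities-surjective : ∀ {α} → α ∈ vecsFrom (upTo (suc n)) k → sameMultiset (toList α) (padded λs k) ≡ true →
    Σ (Vec ℕ n) (λ s → s ∈ seqs k n × inS λs k s ≡ true × multiplicities s ≡ α)
  multiplicities-surjective {α} _ h = s , s∈seqs , s∈S , multiplicities-s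
    where
    length≡n : length (fromMultiplicities α) ≡ n
    length≡n = trans (length-fromMultiplicities α) (trans (sum-↭ (sameMultiset⇒↭ (toList α) (padded λs k) h)) (sumL-padded λs k))
    s : Vec ℕ n
    s = V.cast length≡n (V.fromList (fromMultiplicities α))
    toList-s : toList s ≡ fromMultiplicities α
    toList-s = trans (VP.toList-cast length≡n (V.fromList (fromMultiplicities α))) (VP.toList∘fromList (fromMultiplicities α))
    multiplicities-α : tabulate (λ j → countOcc (k ∸ toℕ j) (fromMultiplicities α)) ≡ α
    multiplicities-α = trans (VP.tabulate-cong (countOcc-fromMultiplicities α)) (VP.tabulate∘lookup α)
    multiplicities-s : multiplicities s ≡ α
    multiplicities-s = trans (cong (λ l → tabulate (λ j → countOcc (k ∸ toℕ j) l)) toList-s) multiplicities-α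
    s∈seqs : s ∈ seqs k n
    s∈seqs = ∈-vecsFrom _ s (subst (All (_∈ upTo (suc (suc k)))) (sym toList-s)
               (All.map (λ (_ , x≤k) → MP.∈-upTo⁺ (s≤s (m≤n⇒m≤1+n x≤k))) (fromMultiplicities-InRange α)))
    α-↭ : toList α ↭ L.map (λ i → countOcc (suc i) (fromMultiplicities α)) (upTo k)
    α-↭ = subst (λ z → toList z ↭ L.map (λ i → countOcc (suc i) (fromMultiplicities α)) (upTo k))
            multiplicities-α (multiplicities-↭ (fromMultiplicities α))
    s∈S : inS λs k s ≡ true
    s∈S rewrite toList-s =
      ∧-true⁺ (fromMultiplicities-weaklyIncreasing α)
        (∧-true⁺ (inRange⁺ k (fromMultiplicities α) (fromMultiplicities-InRange α)) (sameMultiset-↭ˡ (padded λs k) α-↭ h))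

  multiplicities-↭-rearrangements : L.map multiplicities S ↭ rearrangements
  multiplicities-↭-rearrangements =
    Multiplicity.map-filterB-↭ _≟ᵥ_ (vecsFrom (upTo (suc n)) k) (seqs k n) _ (inS λs k) multiplicities
      (Unique-vecsFrom _ k (UniqueP.upTo⁺ (suc n))) (Unique-vecsFrom _ n (UniqueP.upTo⁺ (suc (suc k))))
      multiplicities-injective multiplicities-rearrangement multiplicities-surjective

sumP-map : ∀ {r} {X : Set} (P : X → Poly r) xs β → sumP (L.map P xs) β ≡ sumL (L.map (λ x → P x β) xs)
sumP-map {r} P [] β with does (β ≟ᵥ V.replicate r 0)
... | true = refl
... | false = refl
sumP-map P (x ∷ xs) β = cong (P x β +_) (sumP-map P xs β)

repeatBy-suc : ∀ {k} (c : Fin k → ℕ) (α : Vec ℕ k) → repeatBy (suc ∘ c) α ≡ L.map suc (repeatBy c α)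
repeatBy-suc c [] = refl
repeatBy-suc c (a ∷ α) =
  trans (cong₂ _++_ (sym (LP.map-replicate suc a (c F.zero))) (repeatBy-suc (c ∘ F.suc) α)) (sym (LP.map-++ suc (replicate a (c F.zero)) _))

-- value k - j of fromMultiplicities α gives the factor f(j + 1) = f(k + 1 - (k - j))
repeatBy-↭-fromMultiplicities : ∀ {k} (α : Vec ℕ k) → repeatBy (suc ∘ toℕ) α ↭ L.map (suc k ∸_) (fromMultiplicities α)
repeatBy-↭-fromMultiplicities [] = ↭-refl
repeatBy-↭-fromMultiplicities {suc k} (a ∷ α) = begin
    replicate a 1 ++ repeatBy (suc ∘ toℕ ∘ F.suc) α                       ≡⟨ cong (replicate a 1 ++_) (repeatBy-suc (suc ∘ toℕ) α) ⟩
    replicate a 1 ++ L.map suc (repeatBy (suc ∘ toℕ) α)                   ↭⟨ PP.++⁺ˡ (replicate a 1) (PP.map⁺ suc (repeatBy-↭-fromMultiplicities α)) ⟩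
    replicate a 1 ++ L.map suc (L.map (suc k ∸_) (fromMultiplicities α))  ↭⟨ PP.++-comm (replicate a 1) _ ⟩
    L.map suc (L.map (suc k ∸_) (fromMultiplicities α)) ++ replicate a 1  ≡⟨ cong₂ _++_ shift-below top ⟨
    L.map (2 + k ∸_) (fromMultiplicities α) ++ L.map (2 + k ∸_) (replicate a (suc k))
                                                                          ≡⟨ LP.map-++ (2 + k ∸_) (fromMultiplicities α) _ ⟨
    L.map (2 + k ∸_) (fromMultiplicities (a ∷ α)) ∎
  where
  open Perm.PermutationReasoning
  shift-below : L.map (2 + k ∸_) (fromMultiplicities α) ≡ L.map suc (L.map (suc k ∸_) (fromMultiplicities α))
  shift-below = trans (LP.map-cong-local (All.map (λ (_ , x≤k) → +-∸-assoc 1 (m≤n⇒m≤1+n x≤k)) (fromMultiplicities-InRange α)))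
                      (LP.map-∘ (fromMultiplicities α))
  top : L.map (2 + k ∸_) (replicate a (suc k)) ≡ replicate a 1
  top = trans (LP.map-replicate (2 + k ∸_) a (suc k)) (cong (replicate a) (trans (+-∸-assoc 1 (≤-refl {k})) (cong suc (n∸n≡0 k))))

propositionP : (r : ℕ) → 1 ≤ r → (β : Vec ℕ r) →
    (λs : List ℕ) → All (λ x → 1 ≤ x) λs → Linked _≥_ λs →
    (k : ℕ) → length λs ≤ k →
    coeff (monomialSym λs k (λ j → fpoly r (suc (toℕ j)))) β
      ≡ countTuples r λs k β
propositionP r _ β λs _ _ k _ = begin
    sumP (L.map (monomialTerm r (suc ∘ toℕ)) rearrangements) β
  ≡⟨ sumP-map (monomialTerm r (suc ∘ toℕ)) rearrangements β ⟩
    sumL (L.map (λ α → monomialTerm r (suc ∘ toℕ) α β) rearrangements)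
  ≡⟨ sumL-map-cong (λ α → coeff-monomialTerm r (suc ∘ toℕ) α β) rearrangements ⟩
    sumL (L.map termCoeff rearrangements)
  ≡⟨ sum-↭ (PP.map⁺ termCoeff multiplicities-↭-rearrangements) ⟨
    sumL (L.map termCoeff (L.map multiplicities S))
  ≡⟨ cong sumL (LP.map-∘ S) ⟨
    sumL (L.map (termCoeff ∘ multiplicities) S)
  ≡⟨ cong sumL (LP.map-cong-local (All.map (λ {s} → termCoeff≡#admissibleTuples {s}) (All-filterB-true (inS λs k) (seqs k n)))) ⟩
    sumL (L.map (λ s → #admissibleTuples k s β) S)
  ≡⟨ countTuples-sumL r λs k β ⟨
    countTuples r λs k β ∎
  where
  open ≡-Reasoning
  open MultiplicityBijection λs k
  termCoeff : Vec ℕ k → ℕ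
  termCoeff α = coeffLinVars (λ _ → repeatBy (suc ∘ toℕ) α) β
  termCoeff≡#admissibleTuples : ∀ {s} → inS λs k s ≡ true → termCoeff (multiplicities s) ≡ #admissibleTuples k s β
  termCoeff≡#admissibleTuples {s} h = begin
      termCoeff (multiplicities s)
    ≡⟨ coeffLinVars-↭ (repeatBy-↭-fromMultiplicities (multiplicities s)) β ⟩
      coeffLinVars (λ _ → L.map (suc k ∸_) (fromMultiplicities (multiplicities s))) β
    ≡⟨ cong (λ l → coeffLinVars (λ _ → L.map (suc k ∸_) l) β) (fromMultiplicities∘multiplicities s (inS⁻ s h)) ⟨
      coeffLinVars (λ _ → L.map (suc k ∸_) (toList s)) β
    ≡⟨ #admissibleTuples-coeffLinVars k s (All.map proj₂ (InS.inRange (inS⁻ s h))) β ⟨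
      #admissibleTuples k s β ∎
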